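{- Every finite simple graph $G$ satisfies $\pi^{c}(G)\le \gamma_R(G)$.
   Context: A roman dominating function of $G$ is a labeling $f:V(G)\to\{0,1,2\}$ such that every vertex labeled $0$ is adjacent to some vertex labeled $2$; the roman domination number $\gamma_R(G)$ is the minimum of $\sum_v f(v)$ over roman dominating functions. A configuration of cops on $G$ is a function $C:V(G)\to\mathbb{Z}_{\ge 0}$ of size $\sum_v C(v)$. A pebbling step from a vertex $u$ with at least two cops to an adjacent vertex $v$ removes two cops from $u$ and adds one cop to $v$. In the cops and robbers pebbling game, cops are placed according to $C$, then a robber chooses a starting vertex; thereafter, in each turn the cops make pebbling steps, after which the robber either moves to an adjacent vertex or stays put. The robber is captured when he occupies a vertex holding at least one cop. The cop pebbling number $\pi^{c}(G)$ is the minimum $m$ such that some configuration of size $m$ allows the cops to capture the robber regardless of how he starts and moves. -}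

module Defs where

open import Data.Nat using (ℕ; zero; suc; _+_; _∸_; _≤_)
open import Data.Fin using (Fin; _≟_)
open import Data.Bool using (Bool; true; false; T; if_then_else_)
open import Data.List using (List; map; allFin)
open import Data.Nat.ListAction using (sum)
open import Data.Product using (Σ; _×_; _,_)
open import Data.Sum using (_⊎_)
open import Relation.Nullary.Decidable using (⌊_⌋)
open import Relation.Binary.PropositionalEquality using (_≡_)
open import Relation.Binary.Construct.Closure.ReflexiveTransitive using (Star)

record SimpleGraph (n : ℕ) : Set where
  field
    adj    : Fin n → Fin n → Bool
    sym    : ∀ u v → adj u v ≡ adj v u
    irrefl : ∀ u → adj u u ≡ false

open SimpleGraph public

Edge : ∀ {n} → SimpleGraph n → Fin n → Fin n → Set
Edge G u v = T (adj G u v)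

total : ∀ {n} → (Fin n → ℕ) → ℕ
total {n} f = sum (map f (allFin n))

record RomanDominating {n} (G : SimpleGraph n) (f : Fin n → ℕ) : Set where
  field
    bounded   : ∀ v → f v ≤ 2
    dominated : ∀ v → f v ≡ 0 → Σ (Fin n) λ u → Edge G v u × f u ≡ 2

weight : ∀ {n} → (Fin n → ℕ) → ℕ
weight = total

Config : ℕ → Set
Config n = Fin n → ℕ

size : ∀ {n} → Config n → ℕ
size = total

pebble : ∀ {n} → Config n → Fin n → Fin n → Config n
pebble C u v w =
  (if ⌊ w ≟ u ⌋ then C w ∸ 2 else C w) + (if ⌊ w ≟ v ⌋ then 1 else 0)

data Step {n} (G : SimpleGraph n) (C : Config n) : Config n → Set where
  step : ∀ u v → Edge G u v → 2 ≤ C u → Step G C (pebble C u v)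

CopTurn : ∀ {n} → SimpleGraph n → Config n → Config n → Set
CopTurn G = Star (Step G)

-- Win G C r : with cops in configuration C, the robber at r, and the cops
-- to move, the cops can force capture in finitely many turns.
data Win {n} (G : SimpleGraph n) : Config n → Fin n → Set where
  caught : ∀ {C r} → 1 ≤ C r → Win G C r
  turn   : ∀ {C C' r} → CopTurn G C C' →
           (1 ≤ C' r ⊎ (∀ r' → (r' ≡ r ⊎ Edge G r r') → Win G C' r')) →
           Win G C r

CopWinning : ∀ {n} → SimpleGraph n → Config n → Set
CopWinning {n} G C = ∀ (r : Fin n) → Win G C r

-- π^c(G) ≤ m  (some winning configuration of size at most m)
CopPebblingAtMost : ∀ {n} → SimpleGraph n → ℕ → Set
CopPebblingAtMost {n} G m = Σ (Config n) λ C → CopWinning G C × size C ≤ m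

{-# OPTIONS --safe #-}
module Submission where

open import Defs
open import Data.Nat using (ℕ; zero; suc; _≤_; s≤s; z≤n)
open import Data.Nat.Properties using (m≤n+m; ≤-refl)
open import Data.Fin using (Fin; _≟_)
open import Data.Bool using (T)
open import Data.Product using (_,_)
open import Data.Sum using (inj₁)
open import Relation.Nullary using (yes; no; contradiction)
open import Relation.Binary.PropositionalEquality using (refl; subst) renaming (sym to ≡-sym)
open import Relation.Binary.Construct.Closure.ReflexiveTransitive using (ε; _◅_)

-- Place the cops according to the roman dominating function. A robber starting
-- on a vertex labelled 1 or 2 is caught at once; one starting on a vertex
-- labelled 0 is caught by a single pebbling step from a neighbour labelled 2.

pebble-target : ∀ {n} (C : Config n) (u v : Fin n) → 1 ≤ pebble C u v v
pebble-target C u v with v ≟ v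
... | yes _   = m≤n+m 1 _
... | no v≢v  = contradiction refl v≢v

Edge-sym : ∀ {n} (G : SimpleGraph n) {u v : Fin n} → Edge G u v → Edge G v u
Edge-sym G {u} {v} = subst T (sym G u v)

romanDominating⇒copWinning : ∀ {n} {G : SimpleGraph n} {f : Fin n → ℕ} →
                             RomanDominating G f → CopWinning G f
romanDominating⇒copWinning {G = G} {f} rd r with f r in fr≡
... | suc _ = caught (subst (1 ≤_) (≡-sym fr≡) (s≤s z≤n))
... | zero with RomanDominating.dominated rd r fr≡
...   | u , r~u , fu≡2 =
  turn (step u r (Edge-sym G r~u) (subst (2 ≤_) (≡-sym fu≡2) ≤-refl) ◅ ε)
       (inj₁ (pebble-target f u r))

theorem5 : ∀ (n : ℕ) (G : SimpleGraph n) (f : Fin n → ℕ) →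
           RomanDominating G f → CopPebblingAtMost G (weight f)
theorem5 n G f rd = f , romanDominating⇒copWinning rd , ≤-refl
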